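{- Let $G$ be a graph with vertices $v_1,\dots,v_n$, where each vertex $v_i$ has a lower bound $\mathrm{lbound}(v_i)\in\mathbb{Q}\cup\{ -\infty\}$ and an upper bound $\mathrm{ubound}(v_i)\in\mathbb{Q}\cup\{+\infty\}$. Suppose there exists a bounded representation $\mathcal{R}=(\ell_1,\dots,\ell_n)$ of $G$. Then there exists a bounded representation $\mathcal{R}'=(\ell'_1,\dots,\ell'_n)$ of $G$ such that for every pair of indistinguishable vertices $v_i,v_j$ with $\mathrm{lbound}(v_i)\le \mathrm{lbound}(v_j)$ it holds that $\ell'_i\le \ell'_j$.
   Context: A unit interval representation of $G$ assigns to each vertex $v_i$ a real number $\ell_i$ (the left endpoint of the closed interval $[\ell_i,\ell_i+1]$) such that $v_iv_j\in E(G)$ if and only if the intervals $[\ell_i,\ell_i+1]$ and $[\ell_j,\ell_j+1]$ intersect, i.e. $|\ell_i-\ell_j|\le 1$. It is a bounded representation if moreover $\mathrm{lbound}(v_i)\le \ell_i\le \mathrm{ubound}(v_i)$ for every $i$. Two vertices $u,v$ are indistinguishable if $N[u]=N[v]$ (equal closed neighborhoods).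
   Formalization: The left endpoints $\ell_i$ and $\ell'_i$ of both bounded representations are rational numbers rather than real numbers. -}

module Defs where

open import Data.Nat using (ℕ)
open import Data.Fin using (Fin)
open import Data.Maybe using (Maybe; just; nothing)
open import Data.Rational using (ℚ; _≤_; _-_; ∣_∣; 1ℚ)
open import Data.Sum using (_⊎_)
open import Data.Product using (_×_; Σ)
open import Data.Empty using (⊥)
open import Data.Unit using (⊤)
open import Relation.Binary.PropositionalEquality using (_≡_; _≢_)
open import Function.Bundles using (_⇔_)
open import Level using (0ℓ)

record Graph (n : ℕ) : Set₁ where
  field
    Adj   : Fin n → Fin n → Set
    sym   : ∀ {i j} → Adj i j → Adj j i
    irrefl : ∀ {i} → Adj i i → ⊥
open Graph public

-- Lower bound: nothing = -∞ ; upper bound: nothing = +∞.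
LBound : Set
LBound = Maybe ℚ

UBound : Set
UBound = Maybe ℚ

_≤lb_ : LBound → ℚ → Set
nothing ≤lb x = ⊤
just a  ≤lb x = a ≤ x

_≤ub_ : ℚ → UBound → Set
x ≤ub nothing = ⊤
x ≤ub just b  = x ≤ b

_≤LB_ : LBound → LBound → Set
nothing ≤LB _       = ⊤
just a  ≤LB nothing = ⊥
just a  ≤LB just b  = a ≤ b

-- Unit interval representation: left endpoints ℓ; distinct vertices are
-- adjacent iff |ℓ_i - ℓ_j| ≤ 1.
IsUnitIntervalRep : ∀ {n} → Graph n → (Fin n → ℚ) → Set
IsUnitIntervalRep {n} G ℓ =
  ∀ (i j : Fin n) → i ≢ j → (Adj G i j ⇔ (∣ ℓ i - ℓ j ∣ ≤ 1ℚ))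

IsBoundedRep : ∀ {n} → Graph n → (Fin n → LBound) → (Fin n → UBound) →
               (Fin n → ℚ) → Set
IsBoundedRep G lb ub ℓ =
  IsUnitIntervalRep G ℓ × (∀ i → (lb i ≤lb ℓ i) × (ℓ i ≤ub ub i))

InClosedNbhd : ∀ {n} → Graph n → Fin n → Fin n → Set
InClosedNbhd G u w = (w ≡ u) ⊎ Adj G u w

Indistinguishable : ∀ {n} → Graph n → Fin n → Fin n → Set
Indistinguishable {n} G u v = ∀ (w : Fin n) → InClosedNbhd G u w ⇔ InClosedNbhd G v w

{-# OPTIONS --safe #-}
module Submission where

-- Send every vertex i to the vertex r i that has the leftmost interval among those
-- indistinguishable from i whose lower bound is at least lb i (i itself included),
-- and place i where r i was.  Indistinguishable vertices are interchangeable in a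
-- unit interval representation, so this is again a representation; lb i ≤ lb (r i)
-- and ℓ (r i) ≤ ℓ i keep the bounds.  If i, j are indistinguishable and
-- lb i ≤ lb j, every candidate for j is a candidate for i, so ℓ (r i) ≤ ℓ (r j).

open import Defs
open import Data.Nat using (ℕ)
open import Data.Fin using (Fin; _≟_)
open import Data.Fin.Properties using (all?)
open import Data.List using (List; filter; allFin)
open import Data.List.Membership.Propositional using (lose)
open import Data.List.Membership.Propositional.Properties using (∈-filter⁺; ∈-allFin)
open import Data.List.Relation.Unary.All.Properties using (all-filter)
open import Data.Maybe using (just; nothing)
open import Data.Product using (Σ; _×_; _,_; proj₁; proj₂)
open import Data.Rational using (ℚ; _≤_; _-_; ∣_∣; 1ℚ; 0ℚ)
open import Data.Rational.Properties using (_≤?_; ≤-refl; ≤-trans; ≤-decTotalOrder; +-inverseʳ)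
open import Relation.Binary using (Decidable; DecTotalOrder)
open import Data.List.Extrema (DecTotalOrder.totalOrder ≤-decTotalOrder) using (argmin; argmin-all; f[argmin]≤f[⊤]; f[argmin]≤v⁺)
open import Data.Sum using (inj₁; inj₂)
open import Data.Unit using (tt)
open import Function using (_∘_)
open import Function.Bundles using (_⇔_; mk⇔; Equivalence)
import Function.Properties.Equivalence as ⇔
open import Relation.Nullary using (Dec; yes; no; contradiction)
open import Relation.Nullary.Decidable using (map′; toWitness; _×-dec_; _⊎-dec_; _→-dec_)
open import Relation.Binary.PropositionalEquality using (_≢_; refl)
  renaming (sym to ≡-sym)

_⇔-dec_ : ∀ {A B : Set} → Dec A → Dec B → Dec (A ⇔ B)
a? ⇔-dec b? = map′ (λ (f , g) → mk⇔ f g) (λ e → Equivalence.to e , Equivalence.from e)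
  ((a? →-dec b?) ×-dec (b? →-dec a?))

∣p-p∣≤1 : ∀ p → ∣ p - p ∣ ≤ 1ℚ
∣p-p∣≤1 p rewrite +-inverseʳ p = toWitness {a? = 0ℚ ≤? 1ℚ} tt

_≤LB?_ : (a b : LBound) → Dec (a ≤LB b)
nothing ≤LB? b      = yes tt
just a  ≤LB? nothing = no λ ()
just a  ≤LB? just b  = a ≤? b

≤LB-refl : ∀ a → a ≤LB a
≤LB-refl nothing  = tt
≤LB-refl (just a) = ≤-refl

≤LB-trans : ∀ a b c → a ≤LB b → b ≤LB c → a ≤LB c
≤LB-trans nothing  _        _        _   _   = tt
≤LB-trans (just a) (just b) (just c) a≤b b≤c = ≤-trans a≤b b≤c

≤LB-≤lb-trans : ∀ a b x → a ≤LB b → b ≤lb x → a ≤lb x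
≤LB-≤lb-trans nothing  _        _ _   _   = tt
≤LB-≤lb-trans (just a) (just b) x a≤b b≤x = ≤-trans a≤b b≤x

≤-≤ub-trans : ∀ b {x y} → y ≤ x → x ≤ub b → y ≤ub b
≤-≤ub-trans nothing  _   _   = tt
≤-≤ub-trans (just b) y≤x x≤b = ≤-trans y≤x x≤b

module ArgminOn {n} (f : Fin n → ℚ) {R : Fin n → Fin n → Set} (R? : Decidable R) where

  candidates : Fin n → List (Fin n)
  candidates i = filter (R? i) (allFin n)

  argminOn : Fin n → Fin n
  argminOn i = argmin f i (candidates i)

  R-argminOn : (∀ i → R i i) → ∀ i → R i (argminOn i)
  R-argminOn R-refl i = argmin-all f (R-refl i) (all-filter (R? i) (allFin n))

  f[argminOn]≤f : ∀ i → f (argminOn i) ≤ f i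
  f[argminOn]≤f i = f[argmin]≤f[⊤] {f = f} i (candidates i)

  f[argminOn]≤f[R] : ∀ {i k} → R i k → f (argminOn i) ≤ f k
  f[argminOn]≤f[R] {i} {k} Rik =
    f[argmin]≤v⁺ {f = f} i (candidates i) (inj₂ (lose (∈-filter⁺ (R? i) (∈-allFin k) Rik) ≤-refl))

module _ {n} (G : Graph n) where

  InClosedNbhd-sym : ∀ {u w} → InClosedNbhd G u w → InClosedNbhd G w u
  InClosedNbhd-sym (inj₁ w≡u) = inj₁ (≡-sym w≡u)
  InClosedNbhd-sym (inj₂ uw)  = inj₂ (Graph.sym G uw)

  adj⇔inClosedNbhd : ∀ {u w} → u ≢ w → Adj G u w ⇔ InClosedNbhd G u w
  adj⇔inClosedNbhd u≢w = mk⇔ inj₂ λ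
    { (inj₁ w≡u) → contradiction (≡-sym w≡u) u≢w
    ; (inj₂ uw)  → uw }

  Indistinguishable-refl : ∀ u → Indistinguishable G u u
  Indistinguishable-refl u w = ⇔.refl

  Indistinguishable-trans : ∀ {u v x} → Indistinguishable G u v → Indistinguishable G v x →
                            Indistinguishable G u x
  Indistinguishable-trans u~v v~x w = ⇔.trans (u~v w) (v~x w)

  indistinguishable? : Decidable (Adj G) → Decidable (Indistinguishable G)
  indistinguishable? adj? u v = all? λ w → inClosedNbhd? u w ⇔-dec inClosedNbhd? v w
    where
    inClosedNbhd? : Decidable (InClosedNbhd G)
    inClosedNbhd? u w = (w ≟ u) ⊎-dec adj? u w

  module _ (ℓ : Fin n → ℚ) (rep : IsUnitIntervalRep G ℓ) where

    adj? : Decidable (Adj G)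
    adj? u w with u ≟ w
    ... | yes refl = no (irrefl G)
    ... | no u≢w   = map′ (Equivalence.from (rep u w u≢w)) (Equivalence.to (rep u w u≢w))
                          (∣ ℓ u - ℓ w ∣ ≤? 1ℚ)

    inClosedNbhd⇔near : ∀ u w → InClosedNbhd G u w ⇔ (∣ ℓ u - ℓ w ∣ ≤ 1ℚ)
    inClosedNbhd⇔near u w with u ≟ w
    ... | yes refl = mk⇔ (λ _ → ∣p-p∣≤1 (ℓ u)) (λ _ → inj₁ refl)
    ... | no u≢w   = ⇔.trans (⇔.sym (adj⇔inClosedNbhd u≢w)) (rep u w u≢w)

    -- Replacing each vertex by an indistinguishable one moves it to a position with the
    -- same closed neighbourhood: i ∈ N[j] ⇔ i ∈ N[r j] ⇔ r j ∈ N[i] ⇔ r j ∈ N[r i].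
    rep∘indistinguishable : (r : Fin n → Fin n) → (∀ i → Indistinguishable G i (r i)) →
                            IsUnitIntervalRep G (ℓ ∘ r)
    rep∘indistinguishable r i~r i j i≢j =
      adj⇔inClosedNbhd i≢j ⟨⇔⟩
      i~r i j ⟨⇔⟩
      symmetric ⟨⇔⟩
      i~r j (r i) ⟨⇔⟩
      symmetric ⟨⇔⟩
      inClosedNbhd⇔near (r i) (r j)
      where
      _⟨⇔⟩_ = ⇔.trans
      infixr 5 _⟨⇔⟩_
      symmetric : ∀ {u w} → InClosedNbhd G u w ⇔ InClosedNbhd G w u
      symmetric = mk⇔ InClosedNbhd-sym InClosedNbhd-sym

mainTheorem1 : ∀ (n : ℕ) (G : Graph n) (lb : Fin n → LBound) (ub : Fin n → UBound) →
    Σ (Fin n → ℚ) (λ ℓ → IsBoundedRep G lb ub ℓ) →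
    Σ (Fin n → ℚ) (λ ℓ' → IsBoundedRep G lb ub ℓ' ×
      (∀ (i j : Fin n) → Indistinguishable G i j → lb i ≤LB lb j → ℓ' i ≤ ℓ' j))
mainTheorem1 n G lb ub (ℓ , rep , bounds) =
  ℓ ∘ r ,
  (rep∘indistinguishable G ℓ rep r (proj₁ ∘ dominated) ,
   λ i → ≤LB-≤lb-trans (lb i) (lb (r i)) _ (proj₂ (dominated i)) (proj₁ (bounds (r i))) ,
         ≤-≤ub-trans (ub i) (f[argminOn]≤f i) (proj₂ (bounds i))) ,
  λ i j i~j lbi≤lbj → f[argminOn]≤f[R]
    (Indistinguishable-trans G i~j (proj₁ (dominated j)) ,
     ≤LB-trans (lb i) (lb j) _ lbi≤lbj (proj₂ (dominated j)))
  where
  Dominates : Fin n → Fin n → Set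
  Dominates i k = Indistinguishable G i k × (lb i ≤LB lb k)

  dominates? : Decidable Dominates
  dominates? i k = indistinguishable? G (adj? G ℓ rep) i k ×-dec (lb i ≤LB? lb k)

  open ArgminOn ℓ dominates?

  r : Fin n → Fin n
  r = argminOn

  dominated : ∀ i → Dominates i (r i)
  dominated = R-argminOn λ i → Indistinguishable-refl G i , ≤LB-refl (lb i)
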